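{- Let $\lambda/\mu$ be a skew shape with $n=|\lambda/\mu|\ge1$ cells. Then the map $$B^{Ss}: T\mapsto \left(\pi^{Q^T},\ Y\!\left(T-\pi^{Q^T}\right)\right)$$ is a bijection from $\mathcal{P}^{Ss}_{\lambda/\mu}$ onto $\mathcal{N}_{\lambda/\mu}\times\mathcal{Y}_n$, and it preserves volume: $|T|=|\pi^{Q^T}|+|Y(T-\pi^{Q^T})|$. Here $T-\pi^{Q^T}$ is the cellwise difference, which is a filling of $\lambda/\mu$ by non-negative integers weakly increasing along rows and columns. The inverse map sends a pair $(\pi^Q, Y=(y_1\le y_2\le\dots\le y_n))\in\mathcal{N}_{\lambda/\mu}\times\mathcal{Y}_n$ to the SsYT $T=\pi^Q+f_Y$, where $f_Y$ is the function on the cells of $\lambda/\mu$ given by $(f_Y)_{Q(k)}=y_k$, $k=1,\dots,n$. In particular, as formal power series in $q$, $$\sum_{T\in\mathcal{P}^{Ss}_{\lambda/\mu}} q^{|T|}=\left(\sum_{\mathsf p\in\mathcal{N}_{\lambda/\mu}} q^{|\mathsf p|}\right)\prod_{k=1}^{n}\frac{1}{1-q^k}.$$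
   Context: Let $\lambda\supseteq\mu$ be partitions. The skew shape $\lambda/\mu$ is the set of cells $(r,c)$ with $1\le r\le \ell(\lambda)$, $\mu_r<c\le\lambda_r$ ($r$ = row index, rows numbered top to bottom; $c$ = column index). A semistandard Young tableau (SsYT) of shape $\lambda/\mu$ is a filling $T=(T_{rc})$ of its cells by non-negative integers, weakly increasing along rows and strictly increasing down columns; $|T|$ is the sum of its entries, and $\mathcal{P}^{Ss}_{\lambda/\mu}$ is the set of all SsYT of shape $\lambda/\mu$. A standard Young tableau (SYT) $Q$ of shape $\lambda/\mu$ with $n$ cells is a filling by $1,\dots,n$, each once, strictly increasing along rows and columns; $Q(k)$ denotes the cell containing $k$. A value $k\in\{1,\dots,n-1\}$ is a descent of $Q$ if $Q(k+1)$ lies in a strictly lower row than $Q(k)$. An SsYT $T$ agrees with $Q$ if $T_{Q(k)}\le T_{Q(k+1)}$ for all $k$, with strict inequality whenever $k$ is a descent of $Q$. The plinth $\pi^Q$ (also written $\mathsf p(Q)$) of an SYT $Q$ is the smallest, with respect to the cellwise partial order $T'\succeq T\iff T'_{rc}\ge T_{rc}$ for all cells, SsYT agreeing with $Q$ (such a smallest element exists). $\mathcal{N}_{\lambda/\mu}=\{\pi^Q: Q \text{ an SYT of shape }\lambda/\mu\}$ is the set of plinths. For an SsYT $T$, $Q^T$ denotes the SYT of shape $\lambda/\mu$ obtained by numbering the cells $1,\dots,n$ in increasing order of their $T$-values, cells with equal $T$-value being numbered from left to right (increasing column index). $\mathcal{Y}_n$ is the set of weakly increasing sequences $Y=(y_1\le\dots\le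 y_n)$ of non-negative integers, with $|Y|=y_1+\dots+y_n$. For a filling $R$ of $\lambda/\mu$ by $n$ non-negative integers, $Y(R)\in\mathcal{Y}_n$ denotes the sequence of its entries listed in weakly increasing order. -}

module Defs where

open import Data.Nat using (ℕ; zero; suc; _+_; _*_; _∸_; _≤_; _<_; _≥_; _<ᵇ_; _≡ᵇ_; _%_)
open import Data.Nat.Properties using (≤-decTotalOrder)
open import Data.Bool using (Bool; true; false; if_then_else_; _∨_; _∧_)
open import Data.List as L using (List; []; _∷_; length; _++_; upTo; allFin)
open import Data.List.Relation.Unary.All using (All)
open import Data.List.Relation.Unary.Linked using (Linked)
open import Data.List.Relation.Unary.Unique.Propositional using (Unique)
open import Data.List.Membership.Propositional using (_∈_)
open import Data.Vec as V using (Vec)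
open import Data.Fin using (Fin)
open import Data.Product using (Σ; _×_; _,_; proj₁; proj₂)
open import Relation.Binary.PropositionalEquality using (_≡_)
import Data.List.Sort
open import Data.Nat.ListAction using () renaming (sum to sumℕ)

-- r-th entry (0-indexed), 0 beyond the end
nth : List ℕ → ℕ → ℕ
nth []       _       = 0
nth (x ∷ xs) zero    = x
nth (x ∷ xs) (suc r) = nth xs r

IsPartition : List ℕ → Set
IsPartition la = Linked _≥_ la × All (λ x → 1 ≤ x) la

_⊆ₚ_ : List ℕ → List ℕ → Set
mu ⊆ₚ la = length mu ≤ length la × (∀ r → nth mu r ≤ nth la r)

-- Cells of the skew shape λ/μ, listed row by row (top to bottom),
-- left to right.  A cell is a pair (row , column), both 1-indexed.

rowCells : ℕ → ℕ → ℕ → List (ℕ × ℕ)   -- row r, columns a+1 .. b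
rowCells r a b = L.map (λ j → (r , a + suc j)) (upTo (b ∸ a))

cellsFrom : ℕ → List ℕ → List ℕ → List (ℕ × ℕ)
cellsFrom r []        mu       = []
cellsFrom r (l ∷ las) []       = rowCells r 0 l ++ cellsFrom (suc r) las []
cellsFrom r (l ∷ las) (m ∷ mus) = rowCells r m l ++ cellsFrom (suc r) las mus

cells : List ℕ → List ℕ → List (ℕ × ℕ)
cells la mu = cellsFrom 1 la mu

size : List ℕ → List ℕ → ℕ
size la mu = length (cells la mu)

open Data.List.Sort ≤-decTotalOrder using (sort)

InY : ℕ → List ℕ → Set
InY n Y = length Y ≡ n × Linked _≤_ Y

-- Notions attached to a fixed skew shape λ/μ.
-- A filling is a vector indexed by the cells (in the order of 'cells').

module Shape (la mu : List ℕ) where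

  n : ℕ
  n = size la mu

  Cell : Set
  Cell = Fin n

  row : Cell → ℕ
  row i = proj₁ (L.lookup (cells la mu) i)

  col : Cell → ℕ
  col i = proj₂ (L.lookup (cells la mu) i)

  Filling : Set
  Filling = Vec ℕ n

  _at_ : Filling → Cell → ℕ
  T at i = V.lookup T i

  vol : Filling → ℕ
  vol T = sumℕ (V.toList T)

  SsYT : Filling → Set
  SsYT T = (∀ i j → row i ≡ row j → col i < col j → T at i ≤ T at j)
         × (∀ i j → col i ≡ col j → row i < row j → T at i < T at j)

  WeakFilling : Filling → Set
  WeakFilling T = (∀ i j → row i ≡ row j → col i < col j → T at i ≤ T at j)
                × (∀ i j → col i ≡ col j → row i < row j → T at i ≤ T at j)

  SYT : Filling → Set
  SYT Q = (∀ i → 1 ≤ Q at i × Q at i ≤ n)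
        × (∀ i j → Q at i ≡ Q at j → i ≡ j)
        × (∀ i j → row i ≡ row j → col i < col j → Q at i < Q at j)
        × (∀ i j → col i ≡ col j → row i < row j → Q at i < Q at j)

  -- T agrees with Q: for Q(k) = i, Q(k+1) = j we need T_i ≤ T_j,
  -- strictly if k is a descent (j in a strictly lower row than i)
  Agrees : Filling → Filling → Set
  Agrees T Q = ∀ i j → Q at j ≡ suc (Q at i)
             → (T at i ≤ T at j) × (row i < row j → T at i < T at j)

  _≼_ : Filling → Filling → Set
  T ≼ T' = ∀ i → T at i ≤ T' at i

  IsPlinth : Filling → Filling → Set
  IsPlinth Q p = SsYT p × Agrees p Q × (∀ T → SsYT T → Agrees T Q → p ≼ T)

  InN : Filling → Set
  InN p = Σ Filling (λ Q → SYT Q × IsPlinth Q p)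

  -- Q^T : number cells in increasing order of T-value, ties from left
  -- to right; the number of cell i is 1 + #(cells numbered before i)
  before : Filling → Cell → Cell → Bool
  before T j i = (T at j <ᵇ T at i) ∨ ((T at j ≡ᵇ T at i) ∧ (col j <ᵇ col i))

  std : Filling → Filling
  std T = V.tabulate (λ i → suc (sumℕ (L.map (λ j → if before T j i then 1 else 0) (allFin n))))

  _⊖_ : Filling → Filling → Filling
  T ⊖ p = V.zipWith _∸_ T p

  _⊕_ : Filling → Filling → Filling
  T ⊕ p = V.zipWith _+_ T p

  Ysort : Filling → List ℕ
  Ysort R = sort (V.toList R)

  -- f_Y (relative to the SYT Q):  (f_Y)_{Q(k)} = y_k
  fY : Filling → List ℕ → Filling
  fY Q Y = V.map (λ q → nth Y (q ∸ 1)) Q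

-- Formal power series in q with ℕ coefficients, as coefficient functions

PS : Set
PS = ℕ → ℕ

sumTo : ℕ → (ℕ → ℕ) → ℕ
sumTo zero    f = f 0
sumTo (suc m) f = sumTo m f + f (suc m)

_⋆_ : PS → PS → PS
(f ⋆ g) m = sumTo m (λ i → f i * g (m ∸ i))

one : PS
one zero    = 1
one (suc _) = 0

-- 1 / (1 - q^(k+1))
geomS : ℕ → PS
geomS k r = if (r % suc k) ≡ᵇ 0 then 1 else 0

prodGeom : ℕ → PS
prodGeom zero    = one
prodGeom (suc n) = prodGeom n ⋆ geomS n

HasCount : {A : Set} → (A → Set) → ℕ → Set
HasCount {A} P k = Σ (List A) (λ xs → Unique xs × (∀ x → (x ∈ xs → P x) × (P x → x ∈ xs)) × length xs ≡ k)

-- The plinth of a standard tableau Q is explicit: the cell Q(k) receives the number of descents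
-- of Q smaller than k.  If an SsYT T agrees with Q, every descent passed along Q forces T to grow
-- by one, so T − π^Q is still weakly increasing along Q; since T always agrees with its own
-- standardisation Q^T, the pair (π^{Q^T}, sorted T − π^{Q^T}) determines T, the sorted list
-- being read back along Q^T.  Conversely π^Q + f_Y has standardisation Q: its ties only occur
-- between cells with the same number of preceding descents, and those are strictly left to right.
-- The generating function then reduces to counting 𝒴_n by weight: subtracting the smallest
-- entry y from the other n − 1 entries identifies 𝒴_n with 𝒴_{n−1} × ℕ, of weight |Y'| + n y.
module Submission where

open import Defs
open import Data.Nat using (ℕ; _+_; _≤_)
open import Data.List using (List)
open import Data.Nat.ListAction using () renaming (sum to sumℕ)
open import Data.Product using (Σ; _×_; _,_)
open import Relation.Binary.PropositionalEquality using (_≡_)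

open import Data.Bool using (Bool; true; false; if_then_else_)
open import Data.Empty using (⊥-elim)
open import Data.Fin as F using (Fin; zero; suc; toℕ; fromℕ<)
import Data.Fin.Properties as FP
open import Data.List as L using ([]; _∷_; length; _++_; allFin; applyUpTo)
open import Data.List.Membership.Propositional using (_∈_)
open import Data.List.Membership.Propositional.Properties
open import Data.List.Properties
  using (length-map; length-++; length-tabulate; map-cong; map-∘; map-id-local; map-applyUpTo; map-tabulate)
open import Data.List.Relation.Binary.Permutation.Propositional
  using (_↭_; ↭-refl; ↭-sym; ↭-trans; ↭-reflexive; prep; ↭⇒↭ₛ)
open import Data.List.Relation.Binary.Permutation.Propositional.Properties
  using (shift; ∈-resp-↭; ↭-length) renaming (map⁺ to ↭-map⁺)
import Data.List.Relation.Binary.Permutation.Setoid.Properties as Permₛ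
open import Data.List.Relation.Binary.Pointwise using (Pointwise-≡⇒≡)
open import Data.List.Relation.Binary.Subset.Propositional using (_⊆_)
open import Data.List.Relation.Unary.All as All using (All; []; _∷_)
open import Data.List.Relation.Unary.Any as Any using (here; there)
open import Data.List.Relation.Unary.Any.Properties using (lookup-index)
open import Data.List.Relation.Unary.Linked as Linked using (Linked; []; [-]; _∷_)
import Data.List.Relation.Unary.Linked.Properties as Linked
open import Data.List.Relation.Unary.Sorted.TotalOrder.Properties using (↗↭↗⇒≋)
open import Data.List.Relation.Unary.Unique.Propositional using (Unique; []; _∷_)
import Data.List.Relation.Unary.Unique.Propositional.Properties as Unique
import Data.List.Sort
open import Data.Nat.Base using (zero; suc; z≤n; s≤s; _≥_; _*_; _∸_; _<_; _⊓_; _<ᵇ_; _≡ᵇ_; _%_; _/_)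
open import Data.Nat.DivMod using (m*[n/m]≡n; m*n/n≡m; m*n%n≡0)
open import Data.Nat.Divisibility using (m%n≡0⇒n∣m)
open import Data.Nat.ListAction.Properties using (sum-↭)
open import Data.Nat.Properties
open import Data.Nat.Tactic.RingSolver using (solve-∀)
open import Data.Product using (proj₁; proj₂)
open import Data.Sum using (_⊎_; inj₁; inj₂)
open import Data.Unit using (tt)
open import Data.Vec as V using (Vec)
import Data.Vec.Properties as VP
open import Function using (id)
open import Relation.Binary.Bundles using (DecTotalOrder)
open import Relation.Binary.Definitions using (Tri; tri<; tri≈; tri>)
open import Relation.Binary.PropositionalEquality
  using (_≢_; refl; sym; trans; cong; cong₂; subst; subst₂; setoid; module ≡-Reasoning)
open import Relation.Nullary using (¬_; Dec; yes; no; does; proof)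
open import Relation.Nullary.Decidable using (_×-dec_)
open import Relation.Nullary.Reflects using (Reflects; invert; ofʸ; ofⁿ; fromEquivalence; _⊎-reflects_; _×-reflects_)

open import Algebra.Properties.CommutativeSemigroup +-commutativeSemigroup using () renaming (interchange to +-interchange)
open Data.List.Sort ≤-decTotalOrder using (sort; sort-↭; sort-↗)

module _ {A : Set} where

  Unique-resp-↭ : ∀ {xs ys : List A} → xs ↭ ys → Unique xs → Unique ys
  Unique-resp-↭ p = Permₛ.Unique-resp-↭ (setoid A) (↭⇒↭ₛ p)

  unique-⊆-⊇⇒↭ : ∀ (xs ys : List A) → Unique xs → Unique ys → xs ⊆ ys → ys ⊆ xs → xs ↭ ys
  unique-⊆-⊇⇒↭ [] [] _ _ _ _ = ↭-refl
  unique-⊆-⊇⇒↭ [] (y ∷ ys) _ _ _ ys⊆[] with () ← ys⊆[] (here refl)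
  unique-⊆-⊇⇒↭ (x ∷ xs) ys (x∉xs ∷ uxs) uys xs⊆ys ys⊆xs
    with us , vs , refl ← ∈-∃++ (xs⊆ys (here refl)) =
    ↭-trans (prep x rest) (↭-sym (shift x us vs))
    where
    x∷us++vs-unique : Unique (x ∷ (us ++ vs))
    x∷us++vs-unique = Unique-resp-↭ (shift x us vs) uys
    rest : xs ↭ us ++ vs
    rest with x∉us++vs ∷ uus++vs ← x∷us++vs-unique =
      unique-⊆-⊇⇒↭ xs (us ++ vs) uxs uus++vs into from
      where
      into : xs ⊆ us ++ vs
      into z∈xs with ∈-resp-↭ (shift x us vs) (xs⊆ys (there z∈xs))
      ... | here refl = ⊥-elim (All.lookup x∉xs z∈xs refl)
      ... | there z∈ = z∈
      from : us ++ vs ⊆ xs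
      from z∈ with ys⊆xs (∈-resp-↭ (↭-sym (shift x us vs)) (there z∈))
      ... | here refl = ⊥-elim (All.lookup x∉us++vs z∈ refl)
      ... | there z∈xs = z∈xs

  lookup-injective : ∀ {xs : List A} → Unique xs → ∀ i j → L.lookup xs i ≡ L.lookup xs j → i ≡ j
  lookup-injective (x∉ ∷ u) zero    zero    _ = refl
  lookup-injective (x∉ ∷ u) zero    (suc j) e = ⊥-elim (All.lookup x∉ (∈-lookup j) e)
  lookup-injective (x∉ ∷ u) (suc i) zero    e = ⊥-elim (All.lookup x∉ (∈-lookup i) (sym e))
  lookup-injective (x∉ ∷ u) (suc i) (suc j) e = cong suc (lookup-injective u i j e)

  sum-map-mono-≤ : ∀ (f g : A → ℕ) xs → (∀ x → f x ≤ g x) → sumℕ (L.map f xs) ≤ sumℕ (L.map g xs)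
  sum-map-mono-≤ f g []       f≤g = z≤n
  sum-map-mono-≤ f g (x ∷ xs) f≤g = +-mono-≤ (f≤g x) (sum-map-mono-≤ f g xs f≤g)

  sum-map-mono-< : ∀ (f g : A → ℕ) xs → (∀ x → f x ≤ g x) → ∀ {y} → y ∈ xs → f y < g y →
    sumℕ (L.map f xs) < sumℕ (L.map g xs)
  sum-map-mono-< f g (x ∷ xs) f≤g (here refl) fy<gy = +-mono-<-≤ fy<gy (sum-map-mono-≤ f g xs f≤g)
  sum-map-mono-< f g (x ∷ xs) f≤g (there y∈) fy<gy = +-mono-≤-< (f≤g x) (sum-map-mono-< f g xs f≤g y∈ fy<gy)

  sum-map-const-1 : ∀ (xs : List A) → sumℕ (L.map (λ _ → 1) xs) ≡ length xs
  sum-map-const-1 []       = refl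
  sum-map-const-1 (x ∷ xs) = cong suc (sum-map-const-1 xs)

injective⇒surjective : ∀ {m} (f : Fin m → Fin m) → (∀ {i j} → f i ≡ f j → i ≡ j) →
  ∀ k → Σ (Fin m) λ i → f i ≡ k
injective⇒surjective {suc m} f f-inj k with FP.any? (λ i → f i FP.≟ k)
... | yes hit = hit
... | no miss = ⊥-elim (1+n≰n (FP.injective⇒≤ punchOut-k∘f-injective))
  where
  punchOut-k∘f : Fin (suc m) → Fin m
  punchOut-k∘f i = F.punchOut {i = k} (λ k≡fi → miss (i , sym k≡fi))
  punchOut-k∘f-injective : ∀ {i j} → punchOut-k∘f i ≡ punchOut-k∘f j → i ≡ j
  punchOut-k∘f-injective {i} {j} e =
    f-inj (FP.punchOut-injective (λ k≡fi → miss (i , sym k≡fi)) (λ k≡fj → miss (j , sym k≡fj)) e)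

sort-unique : ∀ xs ys → xs ↭ ys → Linked _≤_ ys → sort xs ≡ ys
sort-unique xs ys xs↭ys ys↗ = Pointwise-≡⇒≡ (↗↭↗⇒≋ (DecTotalOrder.totalOrder ≤-decTotalOrder)
  (sort-↗ xs) ys↗ (↭⇒↭ₛ (↭-trans (sort-↭ xs) xs↭ys)))

∸1-< : ∀ {v m} → 1 ≤ v → v ≤ m → v ∸ 1 < m
∸1-< {suc v} _ 1+v≤m = 1+v≤m

nth-applyUpTo : ∀ (f : ℕ → ℕ) m k → k < m → nth (applyUpTo f m) k ≡ f k
nth-applyUpTo f (suc m) zero    _         = refl
nth-applyUpTo f (suc m) (suc k) (s≤s k<m) = nth-applyUpTo (λ x → f (suc x)) m k k<m

applyUpTo-nth : ∀ (ys : List ℕ) → applyUpTo (nth ys) (length ys) ≡ ys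
applyUpTo-nth []       = refl
applyUpTo-nth (y ∷ ys) = cong (y ∷_) (applyUpTo-nth ys)

nth-mono : ∀ {ys} → Linked _≤_ ys → ∀ {k l} → k ≤ l → l < length ys → nth ys k ≤ nth ys l
nth-mono {y ∷ []}     _          {zero}  {zero}  _         _        = ≤-refl
nth-mono {y ∷ []}     _          {_}     {suc l} _         (s≤s ())
nth-mono {x ∷ y ∷ ys} _          {zero}  {zero}  _         _        = ≤-refl
nth-mono {x ∷ y ∷ ys} (x≤y ∷ ys↗) {zero}  {suc l} _         (s≤s l<) = ≤-trans x≤y (nth-mono ys↗ {0} {l} z≤n l<)
nth-mono {x ∷ y ∷ ys} (_ ∷ ys↗)   {suc k} {suc l} (s≤s k≤l) (s≤s l<) = nth-mono ys↗ k≤l l<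

nth-antitone : ∀ {xs} → Linked _≥_ xs → ∀ {k l} → k ≤ l → nth xs l ≤ nth xs k
nth-antitone {[]}         _           _                       = z≤n
nth-antitone {x ∷ []}     _           {zero}  {zero}  _         = ≤-refl
nth-antitone {x ∷ []}     _           {zero}  {suc l} _         = z≤n
nth-antitone {x ∷ []}     _           {suc k} {suc l} _         = z≤n
nth-antitone {x ∷ y ∷ xs} _           {zero}  {zero}  _         = ≤-refl
nth-antitone {x ∷ y ∷ xs} (x≥y ∷ xs↘) {zero}  {suc l} _         = ≤-trans (nth-antitone xs↘ {0} {l} z≤n) x≥y
nth-antitone {x ∷ y ∷ xs} (_ ∷ xs↘)   {suc k} {suc l} (s≤s k≤l) = nth-antitone xs↘ k≤l

ind : Bool → ℕ
ind b = if b then 1 else 0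

≡ᵇ-reflects-≡ : ∀ m n → Reflects (m ≡ n) (m ≡ᵇ n)
≡ᵇ-reflects-≡ m n = fromEquivalence (≡ᵇ⇒≡ m n) (≡⇒≡ᵇ m n)

ind-mono : ∀ {P Q : Set} {p q} → Reflects P p → Reflects Q q → (P → Q) → ind p ≤ ind q
ind-mono {p = false} _   _   _   = z≤n
ind-mono {p = true}  {q = true}  _ _ _ = ≤-refl
ind-mono {p = true}  {q = false} rp rq P→Q = ⊥-elim (invert rq (P→Q (invert rp)))

ind-< : ∀ {P Q : Set} {p q} → Reflects P p → Reflects Q q → ¬ P → Q → ind p < ind q
ind-< {p = false} {q = true}  _  _  _  _ = s≤s z≤n
ind-< {p = true}              rp _  ¬P _ = ⊥-elim (¬P (invert rp))
ind-< {q = false}             _  rq _  Q = ⊥-elim (invert rq Q)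

reflects-⇔⇒≡ : ∀ {P Q : Set} {p q} → Reflects P p → Reflects Q q → (P → Q) → (Q → P) → p ≡ q
reflects-⇔⇒≡ (ofʸ P) (ofʸ Q) _   _   = refl
reflects-⇔⇒≡ (ofʸ P) (ofⁿ ¬Q) P⇒Q _   = ⊥-elim (¬Q (P⇒Q P))
reflects-⇔⇒≡ (ofⁿ ¬P) (ofʸ Q) _   Q⇒P = ⊥-elim (¬P (Q⇒P Q))
reflects-⇔⇒≡ (ofⁿ ¬P) (ofⁿ ¬Q) _   _   = refl

gap-trans : ∀ a b c x y z → b + x ≤ a + y → c + y ≤ b + z → c + x ≤ a + z
gap-trans a b c x y z b+x≤a+y c+y≤b+z = +-cancelʳ-≤ (b + y) _ _ (begin
  c + x + (b + y)       ≡⟨ shuffle₁ b c x y ⟩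
  (b + x) + (c + y)     ≤⟨ +-mono-≤ b+x≤a+y c+y≤b+z ⟩
  (a + y) + (b + z)     ≡⟨ shuffle₂ a b y z ⟩
  a + z + (b + y)       ∎)
  where
  open ≤-Reasoning
  shuffle₁ : ∀ b c x y → c + x + (b + y) ≡ (b + x) + (c + y)
  shuffle₁ = solve-∀
  shuffle₂ : ∀ a b y z → (a + y) + (b + z) ≡ a + z + (b + y)
  shuffle₂ = solve-∀

gap⇒∸-mono : ∀ {a b x y} → b + x ≤ a + y → a ≤ x → x ∸ a ≤ y ∸ b
gap⇒∸-mono {a} {b} {x} {y} b+x≤a+y a≤x = m+n≤o⇒m≤o∸n (x ∸ a) (+-cancelʳ-≤ a _ _ (begin
  x ∸ a + b + a         ≡⟨ shuffle (x ∸ a) b a ⟩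
  (x ∸ a + a) + b       ≡⟨ cong (_+ b) (m∸n+n≡m a≤x) ⟩
  x + b                 ≡⟨ +-comm x b ⟩
  b + x                 ≤⟨ b+x≤a+y ⟩
  a + y                 ≡⟨ +-comm a y ⟩
  y + a                 ∎))
  where
  open ≤-Reasoning
  shuffle : ∀ d b a → d + b + a ≡ d + a + b
  shuffle = solve-∀

count-below : ∀ w m → sumℕ (applyUpTo (λ k → ind (k <ᵇ w)) m) ≡ m ⊓ w
count-below w       zero    = refl
count-below zero    (suc m) = trans (count-below zero m) (⊓-zeroʳ m)
count-below (suc w) (suc m) = cong suc (count-below w m)

lookup-ext : ∀ {m} (u v : Vec ℕ m) → (∀ i → V.lookup u i ≡ V.lookup v i) → u ≡ v
lookup-ext u v u≗v = trans (sym (VP.tabulate∘lookup u)) (trans (VP.tabulate-cong u≗v) (VP.tabulate∘lookup v))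

toList≡tabulate-lookup : ∀ {m} (v : Vec ℕ m) → V.toList v ≡ L.tabulate (V.lookup v)
toList≡tabulate-lookup V.[]      = refl
toList≡tabulate-lookup (x V.∷ v) = cong (x ∷_) (toList≡tabulate-lookup v)

toList≡map-lookup : ∀ {m} (v : Vec ℕ m) → V.toList v ≡ L.map (V.lookup v) (allFin m)
toList≡map-lookup v = trans (toList≡tabulate-lookup v) (sym (map-tabulate (λ i → i) (V.lookup v)))

sum-zipWith-+ : ∀ {m} (u v : Vec ℕ m) →
  sumℕ (V.toList (V.zipWith _+_ u v)) ≡ sumℕ (V.toList u) + sumℕ (V.toList v)
sum-zipWith-+ V.[]      V.[]      = refl
sum-zipWith-+ (x V.∷ u) (y V.∷ v) rewrite sum-zipWith-+ u v = +-interchange x y (sumℕ (V.toList u)) (sumℕ (V.toList v))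

-- Counting

module _ {A B : Set} {P : A → Set} {Q : B → Set} where

  HasCount-bij : ∀ {k} (f : A → B) (g : B → A) →
    (∀ x → P x → Q (f x)) → (∀ y → Q y → P (g y)) →
    (∀ x → P x → g (f x) ≡ x) → (∀ y → Q y → f (g y) ≡ y) →
    HasCount P k → HasCount Q k
  HasCount-bij f g P⇒Q Q⇒P g∘f≗id f∘g≗id (xs , xs-unique , xs≐P , refl) =
    L.map f xs , Unique.map⁻ (subst Unique (sym g∘f∘xs≡xs) xs-unique) , mem , length-map f xs
    where
    g∘f∘xs≡xs : L.map g (L.map f xs) ≡ xs
    g∘f∘xs≡xs = trans (sym (map-∘ xs)) (map-id-local (All.tabulate λ {x} x∈ → g∘f≗id x (proj₁ (xs≐P x) x∈)))
    mem : ∀ y → (y ∈ L.map f xs → Q y) × (Q y → y ∈ L.map f xs)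
    mem y = into , from
      where
      into : y ∈ L.map f xs → Q y
      into y∈ with x , x∈ , refl ← ∈-map⁻ f y∈ = P⇒Q x (proj₁ (xs≐P x) x∈)
      from : Q y → y ∈ L.map f xs
      from Qy = subst (_∈ L.map f xs) (f∘g≗id y Qy) (∈-map⁺ f (proj₂ (xs≐P (g y)) (Q⇒P y Qy)))

  length-cartesianProduct : ∀ (xs : List A) (ys : List B) →
    length (L.cartesianProduct xs ys) ≡ length xs * length ys
  length-cartesianProduct []       ys = refl
  length-cartesianProduct (x ∷ xs) ys =
    trans (length-++ (L.map (x ,_) ys)) (cong₂ _+_ (length-map _ ys) (length-cartesianProduct xs ys))

  HasCount-× : ∀ {a b} → HasCount P a → HasCount Q b →
    HasCount (λ (z : A × B) → P (proj₁ z) × Q (proj₂ z)) (a * b)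
  HasCount-× (xs , xs-unique , xs≐P , refl) (ys , ys-unique , ys≐Q , refl) =
    L.cartesianProduct xs ys , Unique.cartesianProduct⁺ xs-unique ys-unique , mem , length-cartesianProduct xs ys
    where
    mem : ∀ z → (z ∈ L.cartesianProduct xs ys → P (proj₁ z) × Q (proj₂ z))
              × (P (proj₁ z) × Q (proj₂ z) → z ∈ L.cartesianProduct xs ys)
    mem (x , y) = (λ z∈ → let x∈ , y∈ = ∈-cartesianProduct⁻ xs ys z∈ in proj₁ (xs≐P x) x∈ , proj₁ (ys≐Q y) y∈)
                , (λ (Px , Qy) → ∈-cartesianProduct⁺ (proj₂ (xs≐P x) Px) (proj₂ (ys≐Q y) Qy))

HasCount-⇔ : ∀ {A : Set} {P Q : A → Set} {k} → (∀ x → P x → Q x) → (∀ x → Q x → P x) → HasCount P k → HasCount Q k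
HasCount-⇔ P⇒Q Q⇒P = HasCount-bij (λ x → x) (λ x → x) P⇒Q Q⇒P (λ _ _ → refl) (λ _ _ → refl)

HasCount-⋃ : ∀ {A : Set} (P : ℕ → A → Set) (c : ℕ → ℕ) → (∀ j → HasCount (P j) (c j)) →
  (∀ {j j' x} → P j x → P j' x → j ≡ j') → ∀ m →
  HasCount (λ x → Σ ℕ λ j → j ≤ m × P j x) (sumTo m c)
HasCount-⋃ P c count disjoint zero =
  HasCount-⇔ (λ x Px → 0 , z≤n , Px) (λ { x (.0 , z≤n , Px) → Px }) (count 0)
HasCount-⋃ P c count disjoint (suc m)
  with xs , xs-unique , xs≐ , |xs| ← HasCount-⋃ P c count disjoint m
     | ys , ys-unique , ys≐ , |ys| ← count (suc m) =
  xs ++ ys , Unique.++⁺ xs-unique ys-unique apart , mem , trans (length-++ xs) (cong₂ _+_ |xs| |ys|)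
  where
  apart : ∀ {v} → ¬ (v ∈ xs × v ∈ ys)
  apart {v} (v∈xs , v∈ys) with j , j≤m , Pj ← proj₁ (xs≐ v) v∈xs =
    1+n≰n (≤-trans (≤-reflexive (sym (disjoint Pj (proj₁ (ys≐ v) v∈ys)))) j≤m)
  mem : ∀ x → (x ∈ xs ++ ys → Σ ℕ λ j → j ≤ suc m × P j x) × ((Σ ℕ λ j → j ≤ suc m × P j x) → x ∈ xs ++ ys)
  mem x = into , from
    where
    into : x ∈ xs ++ ys → Σ ℕ λ j → j ≤ suc m × P j x
    into x∈ with ∈-++⁻ xs x∈
    ... | inj₁ x∈xs = let j , j≤m , Pj = proj₁ (xs≐ x) x∈xs in j , m≤n⇒m≤1+n j≤m , Pj
    ... | inj₂ x∈ys = suc m , ≤-refl , proj₁ (ys≐ x) x∈ys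
    from : (Σ ℕ λ j → j ≤ suc m × P j x) → x ∈ xs ++ ys
    from (j , j≤1+m , Pj) with m≤n⇒m<n∨m≡n j≤1+m
    ... | inj₁ j<1+m = ∈-++⁺ˡ (proj₂ (xs≐ x) (j , ≤-pred j<1+m , Pj))
    ... | inj₂ refl  = ∈-++⁺ʳ xs (proj₂ (ys≐ x) Pj)

HasCount-⋆ : ∀ {A B : Set} (P : ℕ → A → Set) (Q : ℕ → B → Set) {a b : PS} →
  (∀ j → HasCount (P j) (a j)) → (∀ j → HasCount (Q j) (b j)) →
  (∀ {j j' x} → P j x → P j' x → j ≡ j') → ∀ m →
  HasCount (λ (z : A × B) → Σ ℕ λ j → j ≤ m × P j (proj₁ z) × Q (m ∸ j) (proj₂ z)) ((a ⋆ b) m)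
HasCount-⋆ P Q countP countQ P-graded m =
  HasCount-⋃ (λ j z → P j (proj₁ z) × Q (m ∸ j) (proj₂ z)) _
    (λ j → HasCount-× (countP j) (countQ (m ∸ j))) (λ Pj Pj' → P-graded (proj₁ Pj) (proj₁ Pj')) m

geomS-count : ∀ k r → HasCount (λ y → suc k * y ≡ r) (geomS k r)
geomS-count k r with r % suc k ≡ᵇ 0 | ≡ᵇ-reflects-≡ (r % suc k) 0
... | true  | ofʸ r%[1+k]≡0 = r / suc k ∷ [] , [] ∷ [] , (λ y → into y , from y) , refl
  where
  into : ∀ y → y ∈ r / suc k ∷ [] → suc k * y ≡ r
  into y (here refl) = m*[n/m]≡n (m%n≡0⇒n∣m r (suc k) r%[1+k]≡0)
  from : ∀ y → suc k * y ≡ r → y ∈ r / suc k ∷ []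
  from y e = here (sym (trans (cong (_/ suc k) (trans (sym e) (*-comm (suc k) y))) (m*n/n≡m y (suc k))))
... | false | ofⁿ r%[1+k]≢0 =
  [] , [] , (λ y → (λ ()) , λ e → ⊥-elim (r%[1+k]≢0 (trans (cong (_% suc k) (trans (sym e) (*-comm (suc k) y)))
                                                          (m*n%n≡0 y (suc k))))) , refl

sum-map-+ : ∀ y zs → sumℕ (L.map (y +_) zs) ≡ length zs * y + sumℕ zs
sum-map-+ y []       = refl
sum-map-+ y (z ∷ zs) rewrite sum-map-+ y zs = +-interchange y z (length zs * y) (sumℕ zs)

sum-map-∸ : ∀ y zs → All (y ≤_) zs → sumℕ zs ≡ length zs * y + sumℕ (L.map (_∸ y) zs)
sum-map-∸ y []       []           = refl
sum-map-∸ y (z ∷ zs) (y≤z ∷ y≤zs) rewrite sum-map-∸ y zs y≤zs =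
  trans (cong (_+ _) (sym (m+[n∸m]≡n y≤z))) (+-interchange y (z ∸ y) (length zs * y) (sumℕ (L.map (_∸ y) zs)))

head-≤-tail : ∀ {y zs} → Linked _≤_ (y ∷ zs) → All (y ≤_) zs
head-≤-tail [-]           = []
head-≤-tail (y≤z ∷ zs↗) = Linked.Linked⇒All ≤-trans y≤z zs↗

map-∸-map-+ : ∀ y zs → L.map (_∸ y) (L.map (y +_) zs) ≡ zs
map-∸-map-+ y []       = refl
map-∸-map-+ y (z ∷ zs) = cong₂ _∷_ (m+n∸m≡n y z) (map-∸-map-+ y zs)

map-+-map-∸ : ∀ y zs → All (y ≤_) zs → L.map (y +_) (L.map (_∸ y) zs) ≡ zs
map-+-map-∸ y []       []           = refl
map-+-map-∸ y (z ∷ zs) (y≤z ∷ y≤zs) = cong₂ _∷_ (m+[n∸m]≡n y≤z) (map-+-map-∸ y zs y≤zs)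

prodGeom-count : ∀ n k → HasCount (λ Y → InY n Y × sumℕ Y ≡ k) (prodGeom n k)
prodGeom-count zero zero = [] ∷ [] , [] ∷ [] , (λ Y → into Y , from Y) , refl
  where
  into : ∀ Y → Y ∈ [] ∷ [] → InY 0 Y × sumℕ Y ≡ 0
  into Y (here refl) = (refl , []) , refl
  from : ∀ Y → InY 0 Y × sumℕ Y ≡ 0 → Y ∈ [] ∷ []
  from [] _ = here refl
prodGeom-count zero (suc k) = [] , [] , (λ Y → (λ ()) , from Y) , refl
  where
  from : ∀ Y → InY 0 Y × sumℕ Y ≡ suc k → Y ∈ []
  from [] (_ , ())
prodGeom-count (suc n) k =
  HasCount-bij cons uncons cons-InY uncons-InY uncons∘cons cons∘uncons
    (HasCount-⋆ (λ i Y → InY n Y × sumℕ Y ≡ i) (λ r y → suc n * y ≡ r)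
      (prodGeom-count n) (geomS-count n) (λ (_ , e) (_ , e') → trans (sym e) e') k)
  where
  Split : List ℕ × ℕ → Set
  Split (Y , y) = Σ ℕ λ i → i ≤ k × (InY n Y × sumℕ Y ≡ i) × suc n * y ≡ k ∸ i
  cons : List ℕ × ℕ → List ℕ
  cons (Y , y) = y ∷ L.map (y +_) Y
  uncons : List ℕ → List ℕ × ℕ
  uncons []       = [] , 0
  uncons (z ∷ zs) = L.map (_∸ z) zs , z
  cons-InY : ∀ z → Split z → InY (suc n) (cons z) × sumℕ (cons z) ≡ k
  cons-InY (Y , y) (i , i≤k , ((|Y|≡n , Y↗) , refl) , [1+n]y≡k∸i) =
    (cong suc (trans (length-map _ Y) |Y|≡n) , cons↗ Y Y↗) , |cons|≡k
    where
    open ≡-Reasoning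
    cons↗ : ∀ Y → Linked _≤_ Y → Linked _≤_ (y ∷ L.map (y +_) Y)
    cons↗ []      _  = [-]
    cons↗ (w ∷ _) Y↗ = m≤m+n y w ∷ Linked.map⁺ (Linked.map (+-monoʳ-≤ y) Y↗)
    |cons|≡k : y + sumℕ (L.map (y +_) Y) ≡ k
    |cons|≡k = begin
      y + sumℕ (L.map (y +_) Y)      ≡⟨ cong (y +_) (sum-map-+ y Y) ⟩
      y + (length Y * y + sumℕ Y)    ≡⟨ cong (λ l → y + (l * y + sumℕ Y)) |Y|≡n ⟩
      y + (n * y + sumℕ Y)           ≡⟨ +-assoc y (n * y) _ ⟨
      suc n * y + sumℕ Y             ≡⟨ cong (_+ sumℕ Y) [1+n]y≡k∸i ⟩
      k ∸ sumℕ Y + sumℕ Y            ≡⟨ m∸n+n≡m i≤k ⟩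
      k                              ∎
  uncons-InY : ∀ Y → InY (suc n) Y × sumℕ Y ≡ k → Split (uncons Y)
  uncons-InY (z ∷ zs) ((|zs|+1≡n+1 , z∷zs↗) , Σz∷zs≡k) =
    i , i≤k , ((|zs'|≡n , zs'↗) , refl) , [1+n]z≡k∸i
    where
    open ≡-Reasoning
    i = sumℕ (L.map (_∸ z) zs)
    |zs'|≡n = trans (length-map _ zs) (suc-injective |zs|+1≡n+1)
    zs'↗ = Linked.map⁺ (Linked.map (∸-monoˡ-≤ z) (Linked.tail z∷zs↗))
    k≡[1+n]z+i : k ≡ suc n * z + i
    k≡[1+n]z+i = begin
      k                     ≡⟨ Σz∷zs≡k ⟨
      z + sumℕ zs           ≡⟨ cong (z +_) (sum-map-∸ z zs (head-≤-tail z∷zs↗)) ⟩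
      z + (length zs * z + i) ≡⟨ cong (λ l → z + (l * z + i)) (suc-injective |zs|+1≡n+1) ⟩
      z + (n * z + i)       ≡⟨ +-assoc z (n * z) i ⟨
      suc n * z + i         ∎
    i≤k : i ≤ k
    i≤k = ≤-trans (m≤n+m i (suc n * z)) (≤-reflexive (sym k≡[1+n]z+i))
    [1+n]z≡k∸i : suc n * z ≡ k ∸ i
    [1+n]z≡k∸i = sym (trans (cong (_∸ i) k≡[1+n]z+i) (m+n∸n≡m _ i))
  uncons∘cons : ∀ z → Split z → uncons (cons z) ≡ z
  uncons∘cons (Y , y) _ = cong (_, y) (map-∸-map-+ y Y)
  cons∘uncons : ∀ Y → InY (suc n) Y × sumℕ Y ≡ k → cons (uncons Y) ≡ Y
  cons∘uncons (z ∷ zs) ((_ , z∷zs↗) , _) = cong (z ∷_) (map-+-map-∸ z zs (head-≤-tail z∷zs↗))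

-- Cells of a skew shape

∈-rowCells⁻ : ∀ {r a b r' c} → (r' , c) ∈ rowCells r a b → r' ≡ r × a < c × c ≤ b
∈-rowCells⁻ {r} {a} {b} p with j , j∈ , refl ← ∈-map⁻ (λ j → (r , a + suc j)) p =
  refl , m<m+n a (s≤s z≤n) , offset≤ a b j (∈-upTo⁻ j∈)
  where
  offset≤ : ∀ a b j → j < b ∸ a → a + suc j ≤ b
  offset≤ zero    b       j j<b   = j<b
  offset≤ (suc a) (suc b) j j<b∸a = s≤s (offset≤ a b j j<b∸a)

∈-rowCells⁺ : ∀ {r a c b} → a < c → c ≤ b → (r , c) ∈ rowCells r a b
∈-rowCells⁺ {r} {a} {c} {b} a<c c≤b = subst (λ x → (r , x) ∈ rowCells r a b) (trans (+-suc a _) (m+[n∸m]≡n a<c))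
  (∈-map⁺ (λ j → (r , a + suc j)) (∈-upTo⁺ (offset< a b c a<c c≤b)))
  where
  offset< : ∀ a b c → a < c → c ≤ b → c ∸ suc a < b ∸ a
  offset< zero    (suc b) (suc c) (s≤s z≤n)  (s≤s c≤b) = s≤s c≤b
  offset< (suc a) (suc b) (suc c) (s≤s a<c)  (s≤s c≤b) = offset< a b c a<c c≤b

cellsFrom-∷ : ∀ s l las mu → cellsFrom s (l ∷ las) mu ≡ rowCells s (nth mu 0) l ++ cellsFrom (suc s) las (L.drop 1 mu)
cellsFrom-∷ s l las []       = refl
cellsFrom-∷ s l las (m ∷ mu) = refl

nth-drop-1 : ∀ mu d → nth (L.drop 1 mu) d ≡ nth mu (suc d)
nth-drop-1 []       d = refl
nth-drop-1 (m ∷ mu) d = refl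

∈-cellsFrom⁻ : ∀ s la mu {r c} → (r , c) ∈ cellsFrom s la mu →
  Σ ℕ λ d → r ≡ s + d × d < length la × nth mu d < c × c ≤ nth la d
∈-cellsFrom⁻ s (l ∷ las) mu p rewrite cellsFrom-∷ s l las mu with ∈-++⁻ (rowCells s (nth mu 0) l) p
... | inj₁ p₀ with refl , m<c , c≤l ← ∈-rowCells⁻ p₀ = 0 , sym (+-identityʳ s) , s≤s z≤n , m<c , c≤l
... | inj₂ p₁ with d , r≡ , d< , m<c , c≤l ← ∈-cellsFrom⁻ (suc s) las (L.drop 1 mu) p₁ =
  suc d , trans r≡ (sym (+-suc s d)) , s≤s d< , subst (_< _) (nth-drop-1 mu d) m<c , c≤l

∈-cellsFrom⁺ : ∀ s la mu d {c} → d < length la → nth mu d < c → c ≤ nth la d → (s + d , c) ∈ cellsFrom s la mu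
∈-cellsFrom⁺ s (l ∷ las) mu zero    _         m<c c≤l rewrite cellsFrom-∷ s l las mu | +-identityʳ s =
  ∈-++⁺ˡ (∈-rowCells⁺ m<c c≤l)
∈-cellsFrom⁺ s (l ∷ las) mu (suc d) (s≤s d<) m<c c≤l rewrite cellsFrom-∷ s l las mu | +-suc s d =
  ∈-++⁺ʳ (rowCells s (nth mu 0) l)
    (∈-cellsFrom⁺ (suc s) las (L.drop 1 mu) d d< (subst (_< _) (sym (nth-drop-1 mu d)) m<c) c≤l)

rowCells-unique : ∀ r a b → Unique (rowCells r a b)
rowCells-unique r a b = Unique.map⁺ (λ e → suc-injective (+-cancelˡ-≡ a _ _ (cong proj₂ e))) (Unique.upTo⁺ (b ∸ a))

cellsFrom-unique : ∀ s la mu → Unique (cellsFrom s la mu)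
cellsFrom-unique s []        mu = []
cellsFrom-unique s (l ∷ las) mu rewrite cellsFrom-∷ s l las mu =
  Unique.++⁺ (rowCells-unique s (nth mu 0) l) (cellsFrom-unique (suc s) las (L.drop 1 mu)) apart
  where
  apart : ∀ {v} → ¬ (v ∈ rowCells s (nth mu 0) l × v ∈ cellsFrom (suc s) las (L.drop 1 mu))
  apart {r , c} (p , q) with refl , _ ← ∈-rowCells⁻ p | d , r≡ , _ ← ∈-cellsFrom⁻ (suc s) las _ q =
    1+n≰n (≤-trans (s≤s (m≤m+n s d)) (≤-reflexive (sym r≡)))

module SkewShape (la mu : List ℕ) (la-partition : IsPartition la) (mu-partition : IsPartition mu) where

  open Shape la mu

  cell-≡ : ∀ i j → row i ≡ row j → col i ≡ col j → i ≡ j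
  cell-≡ i j r≡ c≡ = lookup-injective (cellsFrom-unique 1 la mu) i j (cong₂ _,_ r≡ c≡)

  cell-bounds : ∀ i → Σ ℕ λ d → row i ≡ suc d × d < length la × nth mu d < col i × col i ≤ nth la d
  cell-bounds i = ∈-cellsFrom⁻ 1 la mu (∈-lookup i)

  cell-at : ∀ d c → d < length la → nth mu d < c → c ≤ nth la d → Σ Cell λ x → row x ≡ suc d × col x ≡ c
  cell-at d c d< m<c c≤l = Any.index p , cong proj₁ (sym (lookup-index p)) , cong proj₂ (sym (lookup-index p))
    where
    p : (suc d , c) ∈ cells la mu
    p = ∈-cellsFrom⁺ 1 la mu d d< m<c c≤l

  corner-below-left : ∀ a b → row a < row b → col a < col b → Σ Cell λ x → row x ≡ row b × col x ≡ col a
  corner-below-left a b ra<rb ca<cb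
    with da , ra≡ , _ , ma<ca , _ ← cell-bounds a | db , rb≡ , db< , _ , cb≤lb ← cell-bounds b
    with x , rx≡ , cx≡ ← cell-at db (col a) db<
           (≤-<-trans (nth-antitone (proj₁ mu-partition) (≤-pred (<⇒≤ (subst₂ _<_ ra≡ rb≡ ra<rb)))) ma<ca)
           (≤-trans (<⇒≤ ca<cb) cb≤lb)
    = x , trans rx≡ (sym rb≡) , cx≡

  corner-above-right : ∀ a b → row a < row b → col a < col b → Σ Cell λ y → row y ≡ row a × col y ≡ col b
  corner-above-right a b ra<rb ca<cb
    with da , ra≡ , da< , ma<ca , _ ← cell-bounds a | db , rb≡ , _ , _ , cb≤lb ← cell-bounds b
    with y , ry≡ , cy≡ ← cell-at da (col b) da< (<-trans ma<ca ca<cb)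
           (≤-trans cb≤lb (nth-antitone (proj₁ la-partition) (≤-pred (<⇒≤ (subst₂ _<_ ra≡ rb≡ ra<rb)))))
    = y , trans ry≡ (sym ra≡) , cy≡

  ⊖-at : ∀ T p i → (T ⊖ p) at i ≡ T at i ∸ p at i
  ⊖-at T p i = VP.lookup-zipWith _∸_ i T p

  ⊕-at : ∀ T p i → (T ⊕ p) at i ≡ T at i + p at i
  ⊕-at T p i = VP.lookup-zipWith _+_ i T p

  fY-at : ∀ Q Y i → fY Q Y at i ≡ nth Y (Q at i ∸ 1)
  fY-at Q Y i = VP.lookup-map i _ Q

  -- Standardisation

  Before : Filling → Cell → Cell → Set
  Before T j i = T at j < T at i ⊎ (T at j ≡ T at i × col j < col i)

  before-reflects : ∀ T j i → Reflects (Before T j i) (before T j i)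
  before-reflects T j i = <ᵇ-reflects-< _ _ ⊎-reflects (≡ᵇ-reflects-≡ _ _ ×-reflects <ᵇ-reflects-< _ _)

  before-irrefl : ∀ T i → ¬ Before T i i
  before-irrefl T i (inj₁ Ti<Ti)       = <-irrefl refl Ti<Ti
  before-irrefl T i (inj₂ (_ , ci<ci)) = <-irrefl refl ci<ci

  before-asym : ∀ T {i j} → Before T j i → ¬ Before T i j
  before-asym T (inj₁ Tj<Ti)       (inj₁ Ti<Tj)       = <-asym Tj<Ti Ti<Tj
  before-asym T (inj₁ Tj<Ti)       (inj₂ (Ti≡Tj , _)) = <-irrefl (sym Ti≡Tj) Tj<Ti
  before-asym T (inj₂ (Tj≡Ti , _)) (inj₁ Ti<Tj)       = <-irrefl (sym Tj≡Ti) Ti<Tj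
  before-asym T (inj₂ (_ , cj<ci)) (inj₂ (_ , ci<cj)) = <-asym cj<ci ci<cj

  before-trans : ∀ T {a b c} → Before T a b → Before T b c → Before T a c
  before-trans T (inj₁ Ta<Tb)         (inj₁ Tb<Tc)         = inj₁ (<-trans Ta<Tb Tb<Tc)
  before-trans T (inj₁ Ta<Tb)         (inj₂ (Tb≡Tc , _))   = inj₁ (<-≤-trans Ta<Tb (≤-reflexive Tb≡Tc))
  before-trans T (inj₂ (Ta≡Tb , _))   (inj₁ Tb<Tc)         = inj₁ (≤-<-trans (≤-reflexive Ta≡Tb) Tb<Tc)
  before-trans T (inj₂ (Ta≡Tb , a<b)) (inj₂ (Tb≡Tc , b<c)) = inj₂ (trans Ta≡Tb Tb≡Tc , <-trans a<b b<c)

  #before : Filling → Cell → ℕ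
  #before T i = sumℕ (L.map (λ j → ind (before T j i)) (allFin n))

  std-at : ∀ T i → std T at i ≡ suc (#before T i)
  std-at T i = VP.lookup∘tabulate _ i

  #before-< : ∀ T {i j} → Before T j i → #before T j < #before T i
  #before-< T {i} {j} j≺i = sum-map-mono-< _ _ (allFin n)
    (λ k → ind-mono (before-reflects T k j) (before-reflects T k i) (λ k≺j → before-trans T k≺j j≺i))
    (∈-allFin j) (ind-< (before-reflects T j j) (before-reflects T j i) (before-irrefl T j) j≺i)

  #before-<n : ∀ T i → #before T i < n
  #before-<n T i = ≤-trans
    (sum-map-mono-< _ (λ _ → 1) (allFin n) (λ k → ind-mono (before-reflects T k i) (ofʸ tt) _)
      (∈-allFin i) (ind-< (before-reflects T i i) (ofʸ tt) (before-irrefl T i) tt))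
    (≤-reflexive (trans (sum-map-const-1 (allFin n)) (length-tabulate (λ i → i))))

  std-< : ∀ T {i j} → Before T j i → std T at j < std T at i
  std-< T {i} {j} j≺i rewrite std-at T i | std-at T j = s≤s (#before-< T j≺i)

  module Standardisation (T : Filling) (T-SsYT : SsYT T) where

    private
      T-row = proj₁ T-SsYT
      T-col = proj₂ T-SsYT

    before-total : ∀ i j → i ≢ j → Before T i j ⊎ Before T j i
    before-total i j i≢j with <-cmp (T at i) (T at j)
    ... | tri< Ti<Tj _ _ = inj₁ (inj₁ Ti<Tj)
    ... | tri> _ _ Tj<Ti = inj₂ (inj₁ Tj<Ti)
    ... | tri≈ _ Ti≡Tj _ with <-cmp (col i) (col j)
    ... | tri< ci<cj _ _ = inj₁ (inj₂ (Ti≡Tj , ci<cj))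
    ... | tri> _ _ cj<ci = inj₂ (inj₂ (sym Ti≡Tj , cj<ci))
    ... | tri≈ _ ci≡cj _ with <-cmp (row i) (row j)
    ... | tri< ri<rj _ _ = ⊥-elim (<-irrefl Ti≡Tj (T-col i j ci≡cj ri<rj))
    ... | tri> _ _ rj<ri = ⊥-elim (<-irrefl (sym Ti≡Tj) (T-col j i (sym ci≡cj) rj<ri))
    ... | tri≈ _ ri≡rj _ = ⊥-elim (i≢j (cell-≡ i j ri≡rj ci≡cj))

    std-injective : ∀ i j → std T at i ≡ std T at j → i ≡ j
    std-injective i j e with i FP.≟ j
    ... | yes i≡j = i≡j
    ... | no i≢j with before-total i j i≢j
    ... | inj₁ i≺j = ⊥-elim (<-irrefl e (std-< T i≺j))
    ... | inj₂ j≺i = ⊥-elim (<-irrefl (sym e) (std-< T j≺i))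

    std-SYT : SYT (std T)
    std-SYT = (λ i → ≤-trans (s≤s z≤n) (≤-reflexive (sym (std-at T i)))
                   , ≤-trans (≤-reflexive (std-at T i)) (#before-<n T i))
            , std-injective
            , (λ i j ri≡rj ci<cj → std-< T (row-before i j ri≡rj ci<cj))
            , (λ i j ci≡cj ri<rj → std-< T (inj₁ (T-col i j ci≡cj ri<rj)))
      where
      row-before : ∀ i j → row i ≡ row j → col i < col j → Before T i j
      row-before i j ri≡rj ci<cj with m≤n⇒m<n∨m≡n (T-row i j ri≡rj ci<cj)
      ... | inj₁ Ti<Tj = inj₁ Ti<Tj
      ... | inj₂ Ti≡Tj = inj₂ (Ti≡Tj , ci<cj)

    std-successor-before : ∀ i j → std T at j ≡ suc (std T at i) → Before T i j
    std-successor-before i j Qj≡1+Qi with i FP.≟ j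
    ... | yes refl = ⊥-elim (1+n≰n (≤-reflexive (sym Qj≡1+Qi)))
    ... | no i≢j with before-total i j i≢j
    ... | inj₁ i≺j = i≺j
    ... | inj₂ j≺i = ⊥-elim (<-asym (std-< T j≺i) (≤-reflexive (sym Qj≡1+Qi)))

    agrees-std : Agrees T (std T)
    agrees-std i j Qj≡1+Qi with std-successor-before i j Qj≡1+Qi
    ... | inj₁ Ti<Tj = <⇒≤ Ti<Tj , λ _ → Ti<Tj
    ... | inj₂ (Ti≡Tj , ci<cj) = ≤-reflexive Ti≡Tj , lower-row-strict
      where
      -- the corner x below i and left of j sits between them: T i < T x ≤ T j
      lower-row-strict : row i < row j → T at i < T at j
      lower-row-strict ri<rj with x , rx≡rj , cx≡ci ← corner-below-left i j ri<rj ci<cj =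
        <-≤-trans (T-col i x (sym cx≡ci) (≤-trans ri<rj (≤-reflexive (sym rx≡rj))))
                  (T-row x j rx≡rj (≤-trans (s≤s (≤-reflexive cx≡ci)) ci<cj))

  -- Descents and plinths

  Descent : Filling → ℕ → Set
  Descent Q k = Σ Cell λ a → Σ Cell λ b → Q at a ≡ k × Q at b ≡ suc k × row a < row b

  descent? : ∀ Q k → Dec (Descent Q k)
  descent? Q k = FP.any? λ a → FP.any? λ b → (Q at a ≟ k) ×-dec ((Q at b ≟ suc k) ×-dec (row a <? row b))

  descents : Filling → ℕ → ℕ
  descents Q zero    = 0
  descents Q (suc k) = descents Q k + ind (does (descent? Q k))

  descents-mono : ∀ Q {k l} → k ≤ l → descents Q k ≤ descents Q l
  descents-mono Q {k} {zero}  z≤n   = ≤-refl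
  descents-mono Q {k} {suc l} k≤1+l with m≤n⇒m<n∨m≡n k≤1+l
  ... | inj₁ k<1+l = ≤-trans (descents-mono Q (≤-pred k<1+l)) (m≤m+n (descents Q l) _)
  ... | inj₂ refl  = ≤-refl

  plinthOf : Filling → Filling
  plinthOf Q = V.tabulate (λ i → descents Q (Q at i))

  plinthOf-at : ∀ Q i → plinthOf Q at i ≡ descents Q (Q at i)
  plinthOf-at Q i = VP.lookup∘tabulate _ i

  module StandardTableau (Q : Filling) (Q-SYT : SYT Q) where

    Q-range : ∀ i → 1 ≤ Q at i × Q at i ≤ n
    Q-range = proj₁ Q-SYT

    Q-injective : ∀ i j → Q at i ≡ Q at j → i ≡ j
    Q-injective = proj₁ (proj₂ Q-SYT)

    Q-row : ∀ i j → row i ≡ row j → col i < col j → Q at i < Q at j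
    Q-row = proj₁ (proj₂ (proj₂ Q-SYT))

    Q-col : ∀ i j → col i ≡ col j → row i < row j → Q at i < Q at j
    Q-col = proj₂ (proj₂ (proj₂ Q-SYT))

    Q-1≤ : ∀ i → 1 ≤ Q at i
    Q-1≤ i = proj₁ (Q-range i)

    Q-∸1< : ∀ i → Q at i ∸ 1 < n
    Q-∸1< i = ∸1-< (Q-1≤ i) (proj₂ (Q-range i))

    rank : Cell → Fin n
    rank i = fromℕ< (Q-∸1< i)

    toℕ-rank : ∀ i → toℕ (rank i) ≡ Q at i ∸ 1
    toℕ-rank i = FP.toℕ-fromℕ< _

    rank-injective : ∀ {i j} → rank i ≡ rank j → i ≡ j
    rank-injective {i} {j} e =
      Q-injective i j (∸-cancelʳ-≡ (Q-1≤ i) (Q-1≤ j) (trans (sym (toℕ-rank i)) (trans (cong toℕ e) (toℕ-rank j))))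

    cellOf : ∀ v → 1 ≤ v → v ≤ n → Σ Cell λ i → Q at i ≡ v
    cellOf v 1≤v v≤n with i , rank-i≡ ← injective⇒surjective rank rank-injective (fromℕ< (∸1-< 1≤v v≤n)) =
      i , ∸-cancelʳ-≡ (Q-1≤ i) 1≤v (trans (sym (toℕ-rank i)) (trans (cong toℕ rank-i≡) (FP.toℕ-fromℕ< _)))

    Q-induction : (R : Cell → Cell → Set) → (∀ a → R a a) →
      (∀ a b c → Q at a ≤ Q at b → Q at b ≤ Q at c → R a b → R b c → R a c) →
      (∀ a b → Q at b ≡ suc (Q at a) → R a b) →
      ∀ a b → Q at a ≤ Q at b → R a b
    Q-induction R R-refl R-trans R-step a b Qa≤Qb = go (Q at b ∸ Q at a) b (m∸n+n≡m Qa≤Qb)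
      where
      go : ∀ d b → d + Q at a ≡ Q at b → R a b
      go zero    b e with refl ← Q-injective a b e = R-refl a
      go (suc d) b e with c , Qc≡ ← cellOf (d + Q at a) (≤-trans (Q-1≤ a) (m≤n+m _ d))
                                        (≤-trans (n≤1+n _) (≤-trans (≤-reflexive e) (proj₂ (Q-range b)))) =
        R-trans a c b (≤-trans (m≤n+m _ d) (≤-reflexive (sym Qc≡)))
                      (≤-trans (≤-reflexive Qc≡) (≤-trans (n≤1+n _) (≤-reflexive e)))
                      (go d c (sym Qc≡)) (R-step c b (trans (sym e) (cong suc (sym Qc≡))))

    values-↭ : L.map (Q at_) (allFin n) ↭ applyUpTo suc n
    values-↭ = unique-⊆-⊇⇒↭ _ _
      (Unique.map⁺ (Q-injective _ _) (Unique.allFin⁺ n))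
      (Unique.applyUpTo⁺₁ suc n (λ i<j _ e → <-irrefl (suc-injective e) i<j))
      into from
      where
      into : L.map (Q at_) (allFin n) ⊆ applyUpTo suc n
      into v∈ with j , _ , refl ← ∈-map⁻ (Q at_) v∈ =
        subst (_∈ applyUpTo suc n) (m+[n∸m]≡n (Q-1≤ j)) (∈-applyUpTo⁺ suc (Q-∸1< j))
      from : applyUpTo suc n ⊆ L.map (Q at_) (allFin n)
      from v∈ with k , k<n , refl ← ∈-applyUpTo⁻ suc v∈ with j , Qj≡ ← cellOf (suc k) (s≤s z≤n) k<n =
        subst (_∈ L.map (Q at_) (allFin n)) Qj≡ (∈-map⁺ (Q at_) (∈-allFin j))

    count-smaller : ∀ v → 1 ≤ v → v ≤ n → sumℕ (L.map (λ j → ind (Q at j <ᵇ v)) (allFin n)) ≡ v ∸ 1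
    count-smaller (suc w) _ 1+w≤n = begin
      sumℕ (L.map (λ j → ind (Q at j <ᵇ suc w)) (allFin n))      ≡⟨ cong sumℕ (map-∘ (allFin n)) ⟩
      sumℕ (L.map (λ q → ind (q <ᵇ suc w)) (L.map (Q at_) (allFin n)))
                                                                 ≡⟨ sum-↭ (↭-map⁺ _ values-↭) ⟩
      sumℕ (L.map (λ q → ind (q <ᵇ suc w)) (applyUpTo suc n))   ≡⟨ cong sumℕ (map-applyUpTo suc _ n) ⟩
      sumℕ (applyUpTo (λ k → ind (k <ᵇ w)) n)                   ≡⟨ count-below w n ⟩
      n ⊓ w                                                      ≡⟨ m≥n⇒m⊓n≡n (<⇒≤ 1+w≤n) ⟩
      w                                                          ∎
      where open ≡-Reasoning

    std-≡ : ∀ T → (∀ i j → Q at j < Q at i → Before T j i) → std T ≡ Q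
    std-≡ T Q<⇒≺ = lookup-ext _ _ λ i → begin
      std T at i
        ≡⟨ std-at T i ⟩
      suc (sumℕ (L.map (λ j → ind (before T j i)) (allFin n)))
        ≡⟨ cong (λ xs → suc (sumℕ xs)) (map-cong (λ j → cong ind (before≡<ᵇ i j)) (allFin n)) ⟩
      suc (sumℕ (L.map (λ j → ind (Q at j <ᵇ Q at i)) (allFin n)))
        ≡⟨ cong suc (count-smaller (Q at i) (Q-1≤ i) (proj₂ (Q-range i))) ⟩
      suc (Q at i ∸ 1)
        ≡⟨ m+[n∸m]≡n (Q-1≤ i) ⟩
      Q at i
        ∎
      where
      open ≡-Reasoning
      ≺⇒Q< : ∀ i j → Before T j i → Q at j < Q at i
      ≺⇒Q< i j j≺i with <-cmp (Q at j) (Q at i)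
      ... | tri< Qj<Qi _ _ = Qj<Qi
      ... | tri≈ _ Qj≡Qi _ with refl ← Q-injective j i Qj≡Qi = ⊥-elim (before-irrefl T i j≺i)
      ... | tri> _ _ Qi<Qj = ⊥-elim (before-asym T j≺i (Q<⇒≺ j i Qi<Qj))
      before≡<ᵇ : ∀ i j → before T j i ≡ (Q at j <ᵇ Q at i)
      before≡<ᵇ i j = reflects-⇔⇒≡ (before-reflects T j i) (<ᵇ-reflects-< _ _) (≺⇒Q< i j) (Q<⇒≺ i j)

    descents-step : ∀ a b → Q at b ≡ suc (Q at a) →
      descents Q (Q at b) ≡ descents Q (Q at a) + ind (does (descent? Q (Q at a)))
    descents-step a b Qb≡1+Qa rewrite Qb≡1+Qa = refl

    descent⇒lower : ∀ a b → Q at b ≡ suc (Q at a) → Descent Q (Q at a) → row a < row b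
    descent⇒lower a b Qb≡1+Qa (a' , b' , Qa'≡Qa , Qb'≡1+Qa , ra'<rb')
      with refl ← Q-injective a' a Qa'≡Qa | refl ← Q-injective b' b (trans Qb'≡1+Qa (sym Qb≡1+Qa)) = ra'<rb'

    no-descent-at-0 : ¬ Descent Q 0
    no-descent-at-0 (a , _ , Qa≡0 , _) = <-irrefl (sym Qa≡0) (Q-1≤ a)

    descents-1 : descents Q 1 ≡ 0
    descents-1 = cong ind (reflects-⇔⇒≡ (proof (descent? Q 0)) (ofⁿ id) no-descent-at-0 (λ ()))

    step-gap : ∀ T → Agrees T Q → ∀ a b → Q at b ≡ suc (Q at a) → ind (does (descent? Q (Q at a))) + T at a ≤ T at b
    step-gap T T-agrees a b Qb≡1+Qa with descent? Q (Q at a)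
    ... | yes d = proj₂ (T-agrees a b Qb≡1+Qa) (descent⇒lower a b Qb≡1+Qa d)
    ... | no _  = proj₁ (T-agrees a b Qb≡1+Qa)

    -- T b − T a is at least the number of descents passed from a to b, written without subtraction.
    agrees-gap : ∀ T → Agrees T Q → ∀ a b → Q at a ≤ Q at b →
      descents Q (Q at b) + T at a ≤ descents Q (Q at a) + T at b
    agrees-gap T T-agrees = Q-induction _ (λ _ → ≤-refl)
      (λ a b c _ _ → gap-trans (D a) (D b) (D c) (T at a) (T at b) (T at c)) step
      where
      D : Cell → ℕ
      D i = descents Q (Q at i)
      step : ∀ a b → Q at b ≡ suc (Q at a) → descents Q (Q at b) + T at a ≤ descents Q (Q at a) + T at b
      step a b Qb≡1+Qa rewrite descents-step a b Qb≡1+Qa | +-assoc (D a) (ind (does (descent? Q (Q at a)))) (T at a) =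
        +-monoʳ-≤ (D a) (step-gap T T-agrees a b Qb≡1+Qa)

    plinthOf-minimal : ∀ T → Agrees T Q → plinthOf Q ≼ T
    plinthOf-minimal T T-agrees b with a , Qa≡1 ← cellOf 1 ≤-refl (≤-trans (Q-1≤ b) (proj₂ (Q-range b))) =
      subst (_≤ T at b) (sym (plinthOf-at Q b)) (begin
        descents Q (Q at b)                    ≤⟨ m≤m+n _ (T at a) ⟩
        descents Q (Q at b) + T at a           ≤⟨ agrees-gap T T-agrees a b (subst (_≤ Q at b) (sym Qa≡1) (Q-1≤ b)) ⟩
        descents Q (Q at a) + T at b           ≡⟨ cong (λ k → descents Q k + T at b) Qa≡1 ⟩
        descents Q 1 + T at b                  ≡⟨ cong (_+ T at b) descents-1 ⟩
        T at b                                 ∎)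
      where open ≤-Reasoning

    lower-step⇒descents-suc : ∀ a b → Q at b ≡ suc (Q at a) → row a < row b →
      descents Q (Q at b) ≡ suc (descents Q (Q at a))
    lower-step⇒descents-suc a b Qb≡1+Qa ra<rb = begin
      descents Q (Q at b)                                          ≡⟨ descents-step a b Qb≡1+Qa ⟩
      descents Q (Q at a) + ind (does (descent? Q (Q at a)))       ≡⟨ cong (λ x → descents Q (Q at a) + ind x)
                                                                        (reflects-⇔⇒≡ (proof (descent? Q (Q at a))) (ofʸ tt)
                                                                          _ (λ _ → a , b , refl , Qb≡1+Qa , ra<rb)) ⟩
      descents Q (Q at a) + 1                                      ≡⟨ +-comm _ 1 ⟩
      suc (descents Q (Q at a))                                    ∎
      where open ≡-Reasoning

    non-descent-step⇒right : ∀ a b → Q at b ≡ suc (Q at a) → ¬ row a < row b → col a < col b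
    non-descent-step⇒right a b Qb≡1+Qa ra≮rb = by-position (m≤n⇒m<n∨m≡n (≮⇒≥ ra≮rb)) (<-cmp (col a) (col b))
      where
      Qa<Qb : Q at a < Q at b
      Qa<Qb = ≤-reflexive (sym Qb≡1+Qa)
      by-position : row b < row a ⊎ row b ≡ row a → Tri (col a < col b) (col a ≡ col b) (col b < col a) → col a < col b
      by-position _            (tri< ca<cb _ _) = ca<cb
      by-position (inj₂ rb≡ra) (tri≈ _ ca≡cb _) = ⊥-elim (<-irrefl (cong (Q at_) (cell-≡ a b (sym rb≡ra) ca≡cb)) Qa<Qb)
      by-position (inj₁ rb<ra) (tri≈ _ ca≡cb _) = ⊥-elim (<-asym Qa<Qb (Q-col b a (sym ca≡cb) rb<ra))
      by-position (inj₂ rb≡ra) (tri> _ _ cb<ca) = ⊥-elim (<-asym Qa<Qb (Q-row b a rb≡ra cb<ca))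
      by-position (inj₁ rb<ra) (tri> _ _ cb<ca) with y , ry≡rb , cy≡ca ← corner-above-right b a rb<ra cb<ca =
        ⊥-elim (<-asym Qa<Qb (<-trans (Q-row b y (sym ry≡rb) (≤-trans cb<ca (≤-reflexive (sym cy≡ca))))
                                      (Q-col y a cy≡ca (≤-trans (s≤s (≤-reflexive ry≡rb)) rb<ra))))

    descents-<-lower-row : ∀ a b → Q at a ≤ Q at b → row a < row b → descents Q (Q at a) < descents Q (Q at b)
    descents-<-lower-row = Q-induction _ (λ a ra<ra → ⊥-elim (<-irrefl refl ra<ra)) R-trans
      (λ a b Qb≡1+Qa ra<rb → ≤-reflexive (sym (lower-step⇒descents-suc a b Qb≡1+Qa ra<rb)))
      where
      R-trans : ∀ a b c → Q at a ≤ Q at b → Q at b ≤ Q at c →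
        (row a < row b → descents Q (Q at a) < descents Q (Q at b)) →
        (row b < row c → descents Q (Q at b) < descents Q (Q at c)) →
        row a < row c → descents Q (Q at a) < descents Q (Q at c)
      R-trans a b c Qa≤Qb Qb≤Qc R-ab R-bc ra<rc with row a <? row b
      ... | yes ra<rb = <-≤-trans (R-ab ra<rb) (descents-mono Q Qb≤Qc)
      ... | no  ra≮rb = ≤-<-trans (descents-mono Q Qa≤Qb) (R-bc (≤-<-trans (≮⇒≥ ra≮rb) ra<rc))

    equal-descents⇒left : ∀ a b → Q at a ≤ Q at b → descents Q (Q at a) ≡ descents Q (Q at b) → a ≡ b ⊎ col a < col b
    equal-descents⇒left = Q-induction _ (λ a _ → inj₁ refl) R-trans R-step
      where
      R-trans : ∀ a b c → Q at a ≤ Q at b → Q at b ≤ Q at c →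
        (descents Q (Q at a) ≡ descents Q (Q at b) → a ≡ b ⊎ col a < col b) →
        (descents Q (Q at b) ≡ descents Q (Q at c) → b ≡ c ⊎ col b < col c) →
        descents Q (Q at a) ≡ descents Q (Q at c) → a ≡ c ⊎ col a < col c
      R-trans a b c Qa≤Qb Qb≤Qc R-ab R-bc Da≡Dc
        with Da≡Db ← ≤-antisym (descents-mono Q Qa≤Qb) (≤-trans (descents-mono Q Qb≤Qc) (≤-reflexive (sym Da≡Dc)))
        with R-ab Da≡Db | R-bc (trans (sym Da≡Db) Da≡Dc)
      ... | inj₁ refl  | b≡c⊎cb<cc     = b≡c⊎cb<cc
      ... | inj₂ ca<cb | inj₁ refl     = inj₂ ca<cb
      ... | inj₂ ca<cb | inj₂ cb<cc    = inj₂ (<-trans ca<cb cb<cc)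
      R-step : ∀ a b → Q at b ≡ suc (Q at a) → descents Q (Q at a) ≡ descents Q (Q at b) → a ≡ b ⊎ col a < col b
      R-step a b Qb≡1+Qa Da≡Db = inj₂ (non-descent-step⇒right a b Qb≡1+Qa λ ra<rb →
        <-irrefl (trans Da≡Db (lower-step⇒descents-suc a b Qb≡1+Qa ra<rb)) (n<1+n _))

    plinthOf-SsYT : SsYT (plinthOf Q)
    plinthOf-SsYT =
        (λ i j ri≡rj ci<cj → subst₂ _≤_ (sym (plinthOf-at Q i)) (sym (plinthOf-at Q j))
                               (descents-mono Q (<⇒≤ (Q-row i j ri≡rj ci<cj))))
      , (λ i j ci≡cj ri<rj → subst₂ _<_ (sym (plinthOf-at Q i)) (sym (plinthOf-at Q j))
                               (descents-<-lower-row i j (<⇒≤ (Q-col i j ci≡cj ri<rj)) ri<rj))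

    plinthOf-agrees : Agrees (plinthOf Q) Q
    plinthOf-agrees i j Qj≡1+Qi rewrite plinthOf-at Q i | plinthOf-at Q j =
        subst (descents Q (Q at i) ≤_) (sym (descents-step i j Qj≡1+Qi)) (m≤m+n _ _)
      , λ ri<rj → ≤-reflexive (sym (lower-step⇒descents-suc i j Qj≡1+Qi ri<rj))

    plinthOf-isPlinth : IsPlinth Q (plinthOf Q)
    plinthOf-isPlinth = plinthOf-SsYT , plinthOf-agrees , (λ T _ T-agrees → plinthOf-minimal T T-agrees)

    std-≡-of-compatible : ∀ T → (∀ i j → Q at i ≤ Q at j → T at i ≤ T at j) →
      (∀ i j → Q at i < Q at j → T at i ≡ T at j → descents Q (Q at i) ≡ descents Q (Q at j)) → std T ≡ Q
    std-≡-of-compatible T T↗ T-ties = std-≡ T Q<⇒≺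
      where
      Q<⇒≺ : ∀ i j → Q at j < Q at i → Before T j i
      Q<⇒≺ i j Qj<Qi with m≤n⇒m<n∨m≡n (T↗ j i (<⇒≤ Qj<Qi))
      ... | inj₁ Tj<Ti = inj₁ Tj<Ti
      ... | inj₂ Tj≡Ti with equal-descents⇒left j i (<⇒≤ Qj<Qi) (T-ties j i Qj<Qi Tj≡Ti)
      ... | inj₁ refl  = ⊥-elim (<-irrefl refl Qj<Qi)
      ... | inj₂ cj<ci = inj₂ (Tj≡Ti , cj<ci)

    sort-along-Q : ∀ h → (∀ {k} → suc k < n → h k ≤ h (suc k)) →
      sort (L.map (λ i → h (Q at i ∸ 1)) (allFin n)) ≡ applyUpTo h n
    sort-along-Q h h↗ = sort-unique _ _
      (↭-trans (↭-reflexive (map-∘ (allFin n)))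
        (↭-trans (↭-map⁺ (λ q → h (q ∸ 1)) values-↭) (↭-reflexive (map-applyUpTo suc _ n))))
      (Linked.applyUpTo⁺₁ h n h↗)

    Ysort-fY : ∀ Y → InY n Y → Ysort (fY Q Y) ≡ Y
    Ysort-fY Y (|Y|≡n , Y↗) = begin
      sort (V.toList (V.map (λ q → nth Y (q ∸ 1)) Q))
        ≡⟨ cong sort (trans (VP.toList-map _ Q) (cong (L.map _) (toList≡map-lookup Q))) ⟩
      sort (L.map (λ q → nth Y (q ∸ 1)) (L.map (Q at_) (allFin n)))
        ≡⟨ cong sort (map-∘ (allFin n)) ⟨
      sort (L.map (λ i → nth Y (Q at i ∸ 1)) (allFin n))
        ≡⟨ sort-along-Q (nth Y) (λ k+1<n → nth-mono Y↗ (n≤1+n _) (subst (_ <_) (sym |Y|≡n) k+1<n)) ⟩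
      applyUpTo (nth Y) n
        ≡⟨ cong (applyUpTo (nth Y)) |Y|≡n ⟨
      applyUpTo (nth Y) (length Y)
        ≡⟨ applyUpTo-nth Y ⟩
      Y ∎
      where open ≡-Reasoning

    -- unrank c₀ k is the cell holding the entry k + 1; the fallback c₀ is returned for k ≥ n
    unrank : Cell → ℕ → Cell
    unrank c₀ k with k <? n
    ... | yes k<n = proj₁ (cellOf (suc k) (s≤s z≤n) k<n)
    ... | no  _   = c₀

    Q-unrank : ∀ c₀ {k} → k < n → Q at unrank c₀ k ≡ suc k
    Q-unrank c₀ {k} k<n with k <? n
    ... | yes k<n' = proj₂ (cellOf (suc k) (s≤s z≤n) k<n')
    ... | no  k≮n  = ⊥-elim (k≮n k<n)

    unrank-rank : ∀ c₀ i → unrank c₀ (Q at i ∸ 1) ≡ i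
    unrank-rank c₀ i = Q-injective _ _ (trans (Q-unrank c₀ (Q-∸1< i)) (m+[n∸m]≡n (Q-1≤ i)))

    fY-Ysort : ∀ R → (∀ i j → Q at i ≤ Q at j → R at i ≤ R at j) → fY Q (Ysort R) ≡ R
    fY-Ysort R R↗ = lookup-ext _ _ λ i → let h = λ k → R at unrank i k in begin
      fY Q (sort (V.toList R)) at i
        ≡⟨ fY-at Q (sort (V.toList R)) i ⟩
      nth (sort (V.toList R)) (Q at i ∸ 1)
        ≡⟨ cong (λ xs → nth (sort xs) (Q at i ∸ 1)) (toList-via-rank i) ⟩
      nth (sort (L.map (λ j → h (Q at j ∸ 1)) (allFin n))) (Q at i ∸ 1)
        ≡⟨ cong (λ xs → nth xs (Q at i ∸ 1)) (sort-along-Q h (h↗ i)) ⟩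
      nth (applyUpTo h n) (Q at i ∸ 1)
        ≡⟨ nth-applyUpTo h n _ (Q-∸1< i) ⟩
      R at unrank i (Q at i ∸ 1)
        ≡⟨ cong (R at_) (unrank-rank i i) ⟩
      R at i ∎
      where
      open ≡-Reasoning
      toList-via-rank : ∀ c₀ → V.toList R ≡ L.map (λ j → R at unrank c₀ (Q at j ∸ 1)) (allFin n)
      toList-via-rank c₀ = trans (toList≡map-lookup R) (map-cong (λ j → cong (R at_) (sym (unrank-rank c₀ j))) (allFin n))
      h↗ : ∀ c₀ {k} → suc k < n → R at unrank c₀ k ≤ R at unrank c₀ (suc k)
      h↗ c₀ k+1<n =
        R↗ _ _ (subst₂ _≤_ (sym (Q-unrank c₀ (<-trans (n<1+n _) k+1<n))) (sym (Q-unrank c₀ k+1<n)) (n≤1+n _))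

  -- The bijection

  std-plinthOf : ∀ Q → SYT Q → std (plinthOf Q) ≡ Q
  std-plinthOf Q Q-SYT = std-≡-of-compatible (plinthOf Q)
    (λ i j Qi≤Qj → subst₂ _≤_ (sym (plinthOf-at Q i)) (sym (plinthOf-at Q j)) (descents-mono Q Qi≤Qj))
    (λ i j _ pi≡pj → trans (sym (plinthOf-at Q i)) (trans pi≡pj (plinthOf-at Q j)))
    where open StandardTableau Q Q-SYT

  plinthOf-unique : ∀ Q p → SYT Q → IsPlinth Q p → p ≡ plinthOf Q
  plinthOf-unique Q p Q-SYT (p-SsYT , p-agrees , p-minimal) = lookup-ext _ _ λ i →
    ≤-antisym (p-minimal (plinthOf Q) plinthOf-SsYT plinthOf-agrees i) (plinthOf-minimal p p-agrees i)
    where open StandardTableau Q Q-SYT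

  module Decomposition (T : Filling) (T-SsYT : SsYT T) where

    open Standardisation T T-SsYT
    open StandardTableau (std T) std-SYT

    p : Filling
    p = plinthOf (std T)

    R : Filling
    R = T ⊖ p

    p≼T : p ≼ T
    p≼T = plinthOf-minimal T agrees-std

    R-at : ∀ i → R at i ≡ T at i ∸ descents (std T) (std T at i)
    R-at i = trans (⊖-at T p i) (cong (T at i ∸_) (plinthOf-at (std T) i))

    R↗ : ∀ i j → std T at i ≤ std T at j → R at i ≤ R at j
    R↗ i j Qi≤Qj rewrite R-at i | R-at j = gap⇒∸-mono (agrees-gap T agrees-std i j Qi≤Qj) (descents≤T i)
      where
      descents≤T : ∀ i → descents (std T) (std T at i) ≤ T at i
      descents≤T i = subst (_≤ T at i) (plinthOf-at (std T) i) (p≼T i)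

    R-weak : WeakFilling R
    R-weak = (λ i j ri≡rj ci<cj → R↗ i j (<⇒≤ (Q-row i j ri≡rj ci<cj)))
           , (λ i j ci≡cj ri<rj → R↗ i j (<⇒≤ (Q-col i j ci≡cj ri<rj)))

    p⊕R≡T : p ⊕ R ≡ T
    p⊕R≡T = lookup-ext _ _ λ i → trans (⊕-at p R i) (trans (cong (p at i +_) (⊖-at T p i)) (m+[n∸m]≡n (p≼T i)))

    p-InN : InN p
    p-InN = std T , std-SYT , plinthOf-isPlinth

    Ysort-InY : InY n (Ysort R)
    Ysort-InY = trans (↭-length (sort-↭ _)) (VP.length-toList R) , sort-↗ _

    recompose : p ⊕ fY (std T) (Ysort R) ≡ T
    recompose = trans (cong (p ⊕_) (fY-Ysort R R↗)) p⊕R≡T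

    vol-split : vol T ≡ vol p + sumℕ (Ysort R)
    vol-split = trans (cong vol (sym p⊕R≡T)) (trans (sum-zipWith-+ p R) (cong (vol p +_) (sym (sum-↭ (sort-↭ _)))))

  module Composition (Q : Filling) (Q-SYT : SYT Q) (Y : List ℕ) (Y-InY : InY n Y) where

    open StandardTableau Q Q-SYT

    T : Filling
    T = plinthOf Q ⊕ fY Q Y

    T-at : ∀ i → T at i ≡ descents Q (Q at i) + nth Y (Q at i ∸ 1)
    T-at i = trans (⊕-at (plinthOf Q) (fY Q Y) i) (cong₂ _+_ (plinthOf-at Q i) (fY-at Q Y i))

    Y↗ : ∀ i j → Q at i ≤ Q at j → nth Y (Q at i ∸ 1) ≤ nth Y (Q at j ∸ 1)
    Y↗ i j Qi≤Qj = nth-mono (proj₂ Y-InY) (∸-monoˡ-≤ 1 Qi≤Qj) (subst (Q at j ∸ 1 <_) (sym (proj₁ Y-InY)) (Q-∸1< j))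

    T↗ : ∀ i j → Q at i ≤ Q at j → T at i ≤ T at j
    T↗ i j Qi≤Qj rewrite T-at i | T-at j = +-mono-≤ (descents-mono Q Qi≤Qj) (Y↗ i j Qi≤Qj)

    T-ties : ∀ i j → Q at i < Q at j → T at i ≡ T at j → descents Q (Q at i) ≡ descents Q (Q at j)
    T-ties i j Qi<Qj Ti≡Tj rewrite T-at i | T-at j with m≤n⇒m<n∨m≡n (descents-mono Q (<⇒≤ Qi<Qj))
    ... | inj₂ Di≡Dj = Di≡Dj
    ... | inj₁ Di<Dj = ⊥-elim (<-irrefl Ti≡Tj (+-mono-<-≤ Di<Dj (Y↗ i j (<⇒≤ Qi<Qj))))

    T-SsYT : SsYT T
    T-SsYT = (λ i j ri≡rj ci<cj → T↗ i j (<⇒≤ (Q-row i j ri≡rj ci<cj)))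
           , (λ i j ci≡cj ri<rj → let Qi≤Qj = <⇒≤ (Q-col i j ci≡cj ri<rj) in
                subst₂ _<_ (sym (T-at i)) (sym (T-at j)) (+-mono-<-≤ (descents-<-lower-row i j Qi≤Qj ri<rj) (Y↗ i j Qi≤Qj)))

    std-T : std T ≡ Q
    std-T = std-≡-of-compatible T T↗ T-ties

    T⊖plinth : T ⊖ plinthOf Q ≡ fY Q Y
    T⊖plinth = lookup-ext _ _ λ i →
      trans (⊖-at T (plinthOf Q) i)
        (trans (cong (_∸ plinthOf Q at i) (⊕-at (plinthOf Q) (fY Q Y) i)) (m+n∸m≡n (plinthOf Q at i) _))

    decompose : (plinthOf (std T) , Ysort (T ⊖ plinthOf (std T))) ≡ (plinthOf Q , Y)
    decompose rewrite std-T | T⊖plinth = cong (plinthOf Q ,_) (Ysort-fY Y Y-InY)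

  B : Filling → Filling × List ℕ
  B T = (plinthOf (std T) , Ysort (T ⊖ plinthOf (std T)))

  B⁻¹ : Filling × List ℕ → Filling
  B⁻¹ (p , Y) = p ⊕ fY (std p) Y

  B⁻¹∘B : ∀ T → SsYT T → B⁻¹ (B T) ≡ T
  B⁻¹∘B T T-SsYT =
    trans (cong (λ Q → p ⊕ fY Q (Ysort R)) (std-plinthOf (std T) (Standardisation.std-SYT T T-SsYT))) recompose
    where open Decomposition T T-SsYT

  B∘B⁻¹ : ∀ p Y → InN p → InY n Y → SsYT (B⁻¹ (p , Y)) × B (B⁻¹ (p , Y)) ≡ (p , Y)
  B∘B⁻¹ p Y (Q , Q-SYT , p-plinth) Y-InY with refl ← plinthOf-unique Q p Q-SYT p-plinth
    rewrite std-plinthOf Q Q-SYT = T-SsYT , decompose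
    where open Composition Q Q-SYT Y Y-InY

  vol-B⁻¹ : ∀ p Y → InN p → InY n Y → vol (B⁻¹ (p , Y)) ≡ vol p + sumℕ Y
  vol-B⁻¹ p Y p-InN Y-InY = trans (Decomposition.vol-split _ T-SsYT) (cong (λ z → vol (proj₁ z) + sumℕ (proj₂ z)) B-B⁻¹)
    where
    T-SsYT = proj₁ (B∘B⁻¹ p Y p-InN Y-InY)
    B-B⁻¹  = proj₂ (B∘B⁻¹ p Y p-InN Y-InY)

  SsYT-count : ∀ (a : ℕ → ℕ) → (∀ j → HasCount (λ p → InN p × vol p ≡ j) (a j)) →
    ∀ m → HasCount (λ T → SsYT T × vol T ≡ m) ((a ⋆ prodGeom n) m)
  SsYT-count a count-N m = HasCount-bij B⁻¹ B into from
    (λ (p , Y) (_ , _ , (p-InN , _) , (Y-InY , _)) → proj₂ (B∘B⁻¹ p Y p-InN Y-InY))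
    (λ T (T-SsYT , _) → B⁻¹∘B T T-SsYT)
    (HasCount-⋆ (λ j p → InN p × vol p ≡ j) (λ r Y → InY n Y × sumℕ Y ≡ r)
      count-N (prodGeom-count n) (λ (_ , e) (_ , e') → trans (sym e) e') m)
    where
    Split : Filling × List ℕ → Set
    Split (p , Y) = Σ ℕ λ j → j ≤ m × (InN p × vol p ≡ j) × (InY n Y × sumℕ Y ≡ m ∸ j)
    into : ∀ z → Split z → SsYT (B⁻¹ z) × vol (B⁻¹ z) ≡ m
    into (p , Y) (j , j≤m , (p-InN , |p|≡j) , (Y-InY , |Y|≡m∸j)) =
        proj₁ (B∘B⁻¹ p Y p-InN Y-InY)
      , trans (vol-B⁻¹ p Y p-InN Y-InY) (trans (cong₂ _+_ |p|≡j |Y|≡m∸j) (m+[n∸m]≡n j≤m))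
    from : ∀ T → SsYT T × vol T ≡ m → Split (B T)
    from T (T-SsYT , |T|≡m) =
        vol p , ≤-trans (m≤m+n _ _) (≤-reflexive m≡) , (p-InN , refl)
      , (Ysort-InY , sym (trans (cong (_∸ vol p) (sym m≡)) (m+n∸m≡n (vol p) _)))
      where
      open Decomposition T T-SsYT
      m≡ : vol p + sumℕ (Ysort R) ≡ m
      m≡ = trans (sym vol-split) |T|≡m

mainTheorem2 : (la mu : List ℕ) → IsPartition la → IsPartition mu → mu ⊆ₚ la → 1 ≤ size la mu →
    let open Shape la mu in
    Σ (Filling → Filling) λ plinth →
    (∀ Q → SYT Q → IsPlinth Q (plinth Q)) ×
    let B : Filling → Filling × List ℕ
        B T = (plinth (std T) , Ysort (T ⊖ plinth (std T)))
    in
    (∀ T → SsYT T → SYT (std T) × plinth (std T) ≼ T × WeakFilling (T ⊖ plinth (std T))) ×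
    (∀ T → SsYT T → InN (plinth (std T)) × InY n (Ysort (T ⊖ plinth (std T)))) ×
    (∀ T T' → SsYT T → SsYT T' → B T ≡ B T' → T ≡ T') ×
    (∀ Q Y → SYT Q → InY n Y → SsYT (plinth Q ⊕ fY Q Y) × B (plinth Q ⊕ fY Q Y) ≡ (plinth Q , Y)) ×
    (∀ T → SsYT T → (plinth (std T) ⊕ fY (std T) (Ysort (T ⊖ plinth (std T)))) ≡ T) ×
    (∀ T → SsYT T → vol T ≡ vol (plinth (std T)) + sumℕ (Ysort (T ⊖ plinth (std T)))) ×
    (∀ (a : ℕ → ℕ) → (∀ j → HasCount (λ p → InN p × vol p ≡ j) (a j)) →
    ∀ m → HasCount (λ T → SsYT T × vol T ≡ m) ((a ⋆ prodGeom n) m))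
mainTheorem2 la mu la-partition mu-partition _ _ =
    plinthOf
  , (λ Q Q-SYT → StandardTableau.plinthOf-isPlinth Q Q-SYT)
  , (λ T T-SsYT → Standardisation.std-SYT T T-SsYT , Decomposition.p≼T T T-SsYT , Decomposition.R-weak T T-SsYT)
  , (λ T T-SsYT → Decomposition.p-InN T T-SsYT , Decomposition.Ysort-InY T T-SsYT)
  , (λ T T' T-SsYT T'-SsYT BT≡BT' → trans (sym (B⁻¹∘B T T-SsYT)) (trans (cong B⁻¹ BT≡BT') (B⁻¹∘B T' T'-SsYT)))
  , (λ Q Y Q-SYT Y-InY → Composition.T-SsYT Q Q-SYT Y Y-InY , Composition.decompose Q Q-SYT Y Y-InY)
  , Decomposition.recompose
  , Decomposition.vol-split
  , SsYT-count
  where open SkewShape la mu la-partition mu-partition
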